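{- Let $n\ge1$ and let $F$ be a facet of ${\cal H}(B(n))$ such that $$F\setminus E(B(n))=\{(p,q)\mid\{p,q\}\in T\}\cup O,$$ where $T$ is a spanning tree of $K_n$ and $O$ is an acyclic orientation of $K_n\setminus T$. Then the number of strict linear orders $L$ on $\{1,\dots,n\}$ such that $F=\Phi(L,T,\mathcal O_L)$, where $\mathcal O_L$ is the orientation of $T$ opposite to $L$, equals the number of linear extensions of the partial order on $\{1,\dots,n\}$ determined by $O$.
   Context: For $n\ge1$, $B(n)$ denotes the aperiodic Brandt semigroup: the set $(\{1,\dots,n\}\times\{1,\dots,n\})\cup\{0\}$, where $0$ is a zero element and $(i,j)(k,l)=(i,l)$ if $j=k$ and $(i,j)(k,l)=0$ otherwise. Its set of idempotents is $E(B(n))=\{0\}\cup\{(i,i)\mid1\le i\le n\}$. For $Y\subseteq B(n)$, $Y^+$ denotes the subsemigroup generated by $Y$ ($\emptyset^+=\emptyset$). The subsemigroup complex ${\cal H}(B(n))$ has vertex set $B(n)$, and a subset $X$ is a face iff it admits an enumeration $x_1,\dots,x_k$ with $\emptyset\subset\{x_1\}^+\subset\cdots\subset\{x_1,\dots,x_k\}^+$ (all inclusions strict); a facet is a maximal face. $K_n$ is the complete undirected graph on $\{1,\dots,n\}$; $K_n\setminus T$ is $K_n$ with the edges of $T$ removed. An orientation of an undirected graph $(V,E)$ is a relation $O\subseteq V\times V$ such that $(p,q)\mapsto\{p,q\}$ is a bijection $O\to E$; it is acyclic if it has no directed cycle. The partial order determined by an acyclic orientation $O$ is $v\le_O w$ iff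 there is a directed path (possibly empty) from $v$ to $w$ using edges of $O$; a linear extension is a strict linear order $<$ with $v<w$ whenever $v\le_O w$ and $v\ne w$. Given a strict linear order $<_L$ and spanning tree $T$, the orientation of $T$ opposite to $L$ is $\mathcal O_L=\{(p,q)\mid\{p,q\}\in T,\ q<_L p\}$, and $\Phi(L,T,\mathcal O_L)=\{0\}\cup\{(i,j)\mid i<_L j\}\cup E(B(n))\cup\mathcal O_L$. -}

module Defs where

open import Level using (0ℓ)
open import Data.Nat using (ℕ; suc; _<_)
open import Data.Fin using (Fin; _≟_)
open import Data.Bool using (Bool; true)
open import Data.Vec using (Vec; lookup)
open import Data.List using (List; []; _∷_; _++_; take; length)
open import Data.List.Membership.Propositional using (_∈_)
open import Data.List.Relation.Unary.Unique.Propositional using (Unique)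
open import Data.List.Relation.Unary.Linked using (Linked)
open import Data.Product using (Σ; _×_; ∃; _,_)
open import Data.Sum using (_⊎_)
open import Data.Empty using (⊥)
open import Relation.Nullary using (¬_; yes; no)
open import Relation.Binary.PropositionalEquality using (_≡_; _≢_)
open import Relation.Binary.Construct.Closure.ReflexiveTransitive using (Star)
open import Relation.Binary.Construct.Closure.Transitive using (TransClosure)
open import Function.Bundles using (_⇔_)

-- The aperiodic Brandt semigroup B(n); vertices 1..n are Fin n.

data BElt (n : ℕ) : Set where
  zeroB : BElt n
  pair  : Fin n → Fin n → BElt n

_·_ : ∀ {n} → BElt n → BElt n → BElt n
zeroB    · _        = zeroB
pair _ _ · zeroB    = zeroB
pair i j · pair k l with j ≟ k
... | yes _ = pair i l
... | no  _ = zeroB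

data IsIdem {n : ℕ} : BElt n → Set where
  idem-zero : IsIdem zeroB
  idem-diag : ∀ i → IsIdem (pair i i)

Subset : ℕ → Set₁
Subset n = BElt n → Set

_⊆_ : ∀ {n} → Subset n → Subset n → Set
X ⊆ Y = ∀ z → X z → Y z

_⊂_ : ∀ {n} → Subset n → Subset n → Set
X ⊂ Y = (X ⊆ Y) × ∃ λ z → Y z × ¬ X z

data Gen {n : ℕ} (Y : Subset n) : Subset n where
  gen-base : ∀ {y} → Y y → Gen Y y
  gen-mul  : ∀ {a b} → Gen Y a → Gen Y b → Gen Y (a · b)

listSet : ∀ {n} → List (BElt n) → Subset n
listSet xs z = z ∈ xs

IsChainEnumeration : ∀ {n} → Subset n → List (BElt n) → Set
IsChainEnumeration X xs =
  Unique xs × (∀ z → (z ∈ xs) ⇔ X z) ×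
  (∀ i → i < length xs → Gen (listSet (take i xs)) ⊂ Gen (listSet (take (suc i) xs)))

IsFace : ∀ {n} → Subset n → Set
IsFace X = Σ (List _) λ xs → IsChainEnumeration X xs

IsFacet : ∀ {n} → Subset n → Set₁
IsFacet {n} F = IsFace F × (∀ (G : Subset n) → IsFace G → F ⊆ G → G ⊆ F)

-- Graphs on {1..n}.  An undirected graph (subgraph of K_n) is given by
-- a symmetric irreflexive relation: {p,q} ∈ T  iff  T p q.

Relation : ℕ → Set₁
Relation n = Fin n → Fin n → Set

IsUndirected : ∀ {n} → Relation n → Set
IsUndirected T = (∀ p q → T p q → T q p) × (∀ p → ¬ T p p)

HasCycle : ∀ {n} → Relation n → Set
HasCycle {n} T = Σ (Fin n) λ x → Σ (Fin n) λ y → Σ (Fin n) λ w → Σ (List (Fin n)) λ rest →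
  Unique (x ∷ y ∷ w ∷ rest) × Linked T ((x ∷ y ∷ w ∷ rest) ++ (x ∷ []))

IsSpanningTree : ∀ {n} → Relation n → Set
IsSpanningTree T = IsUndirected T × (∀ p q → Star T p q) × ¬ HasCycle T

-- O is an orientation of K_n ∖ T : (p,q) ↦ {p,q} is a bijection from O
-- onto the edges {p,q} (p ≠ q) of K_n not in T.
IsOrientationOfComplement : ∀ {n} → Relation n → Relation n → Set
IsOrientationOfComplement {n} T O =
  (∀ p q → O p q → p ≢ q × ¬ T p q) ×                 -- lands in the edge set
  (∀ p q → O p q → ¬ O q p) ×                          -- injective
  (∀ p q → p ≢ q → ¬ T p q → O p q ⊎ O q p)            -- surjective

IsAcyclic : ∀ {n} → Relation n → Set
IsAcyclic {n} O = ∀ (v : Fin n) → ¬ TransClosure O v v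

_≤[_]_ : ∀ {n} → Fin n → Relation n → Fin n → Set
v ≤[ O ] w = Star O v w

-- Relations on {1..n} as n×n Boolean matrices (so they are first-order
-- objects that can be counted).

BoolRel : ℕ → Set
BoolRel n = Vec (Vec Bool n) n

_⟨_⟩_ : ∀ {n} → Fin n → BoolRel n → Fin n → Set
i ⟨ L ⟩ j = lookup (lookup L i) j ≡ true

IsStrictLinearOrder : ∀ {n} → BoolRel n → Set
IsStrictLinearOrder {n} L =
  (∀ i → ¬ (i ⟨ L ⟩ i)) ×
  (∀ i j k → i ⟨ L ⟩ j → j ⟨ L ⟩ k → i ⟨ L ⟩ k) ×
  (∀ i j → i ≢ j → (i ⟨ L ⟩ j) ⊎ (j ⟨ L ⟩ i))

IsLinearExtension : ∀ {n} → BoolRel n → Relation n → Set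
IsLinearExtension L O =
  IsStrictLinearOrder L × (∀ v w → v ≤[ O ] w → v ≢ w → v ⟨ L ⟩ w)

OppOrient : ∀ {n} → BoolRel n → Relation n → Relation n
OppOrient L T p q = T p q × (q ⟨ L ⟩ p)

Φ : ∀ {n} → BoolRel n → Relation n → Subset n
Φ L T z =
  (z ≡ zeroB) ⊎
  (∃ λ i → ∃ λ j → (i ⟨ L ⟩ j) × z ≡ pair i j) ⊎
  IsIdem z ⊎
  (∃ λ p → ∃ λ q → OppOrient L T p q × z ≡ pair p q)

HasCard : {A : Set} → (A → Set) → ℕ → Set
HasCard {A} P k = Σ (List A) λ xs →
  Unique xs × (∀ x → (x ∈ xs) ⇔ P x) × length xs ≡ k

module Submission where

-- (1) A facet F of H(B(n)) contains every idempotent.  Independence of an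
--     enumeration (each element lies outside the subsemigroup generated by
--     its predecessors) survives the following rearrangement: list all
--     idempotents 0, (1,1), …, (n,n) first, then the non-idempotent elements
--     of F in their original order.  The key semigroup fact is that a set Q
--     of idempotents acts as partial identities: ⟨Q ∪ S⟩ ⊆ Q ∪ {0} ∪ ⟨S⟩.
--     Hence E(B(n)) ∪ F is a face, and maximality of F gives E(B(n)) ⊆ F.
--
-- (2) Once E(B(n)) ⊆ F and F ∖ E(B(n)) consists of the pairs of T (both
--     directions) and of O, a strict linear order L satisfies F = Φ(L,T,O_L)
--     iff L ⊆ F, and L is a linear extension of ≤_O iff L ⊆ F as well.
--
-- Both sets of orders therefore coincide with the set of strict linear
-- orders contained in F; this set is decidable (F is finite), so it has a
-- cardinality, which is then shared by the two sets in the theorem.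

open import Defs
open import Data.Nat using (ℕ; zero; suc; _≤_; _<_; s≤s; z≤n)
open import Data.Fin using (Fin; _≟_)
open import Data.Fin.Properties using (all?)
open import Data.Bool using (true; false)
import Data.Bool.Properties as Bool
open import Data.Vec using (Vec; []; _∷_; lookup)
import Data.Vec.Properties as Vec
open import Data.Unit using (⊤; tt)
open import Data.Product using (∃; _×_; _,_; proj₁; proj₂)
open import Data.Sum using (_⊎_; inj₁; inj₂; [_,_])
open import Data.Empty using (⊥; ⊥-elim)
open import Data.List using (List; []; _∷_; _++_; take; length; map; filter; allFin; cartesianProductWith; deduplicate)
open import Data.List.Membership.Propositional using (_∈_)
open import Data.List.Membership.Propositional.Properties using (∈-map⁺; ∈-map⁻; ∈-++⁺ˡ; ∈-++⁺ʳ; ∈-++⁻; ∈-filter⁺; ∈-filter⁻; ∈-allFin; ∈-cartesianProductWith⁺; ∈-deduplicate⁺)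
import Data.List.Membership.DecPropositional as DecMembership
open import Data.List.Relation.Unary.Any using (here; there)
open import Data.List.Relation.Unary.All as All using ()
open import Data.List.Relation.Unary.Unique.Propositional using (Unique; []; _∷_)
import Data.List.Relation.Unary.Unique.Propositional.Properties as Unique
import Data.List.Relation.Unary.Unique.DecPropositional.Properties as UniqueDec
open import Relation.Nullary using (¬_; yes; no; Dec; ¬?)
open import Relation.Nullary.Decidable using (_×-dec_; _→-dec_; _⊎-dec_)
open import Relation.Unary using (Decidable)
open import Relation.Binary.Definitions using (DecidableEquality)
open import Relation.Binary.PropositionalEquality using (_≡_; _≢_; refl; sym)
open import Relation.Binary.Construct.Closure.ReflexiveTransitive using (ε; _◅_)
open import Function.Base using (_∘_)
open import Function.Bundles using (_⇔_; mk⇔; Equivalence)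

module _ {n : ℕ} where

  infixr 6 _∪_
  _∪_ : Subset n → Subset n → Subset n
  (X ∪ Y) z = X z ⊎ Y z

  ｛_｝ : BElt n → Subset n
  ｛ x ｝ z = z ≡ x

  ∅ : Subset n
  ∅ _ = ⊥

  infix 4 _≐_
  _≐_ : Subset n → Subset n → Set
  X ≐ Y = X ⊆ Y × Y ⊆ X

  ≐-sym : ∀ {X Y} → X ≐ Y → Y ≐ X
  ≐-sym (X⊆Y , Y⊆X) = Y⊆X , X⊆Y

  ≐-trans : ∀ {X Y Z} → X ≐ Y → Y ≐ Z → X ≐ Z
  ≐-trans (a , a') (b , b') = (λ z x → b z (a z x)) , (λ z x → a' z (b' z x))

  ∪-congˡ : ∀ {X Y Z} → X ≐ Y → X ∪ Z ≐ Y ∪ Z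
  ∪-congˡ (a , b) = (λ z → [ (λ x → inj₁ (a z x)) , inj₂ ]) , (λ z → [ (λ y → inj₁ (b z y)) , inj₂ ])

  ∪-[] : ∀ P → P ∪ listSet [] ≐ P
  ∪-[] P = (λ { z (inj₁ p) → p ; z (inj₂ ()) }) , (λ z → inj₁)

  ∪-∷ : ∀ P x ys → P ∪ listSet (x ∷ ys) ≐ (P ∪ ｛ x ｝) ∪ listSet ys
  ∪-∷ P x ys =
    (λ { z (inj₁ p) → inj₁ (inj₁ p) ; z (inj₂ (here e)) → inj₁ (inj₂ e) ; z (inj₂ (there m)) → inj₂ m }) ,
    (λ { z (inj₁ (inj₁ p)) → inj₁ p ; z (inj₁ (inj₂ e)) → inj₂ (here e) ; z (inj₂ m) → inj₂ (there m) })

  ⊂-resp : ∀ {X X' Y Y'} → X ≐ X' → Y ≐ Y' → X ⊂ Y → X' ⊂ Y'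
  ⊂-resp (_ , X'⊆X) (Y⊆Y' , _) (X⊆Y , z , yz , ¬xz) =
    (λ w x'w → Y⊆Y' w (X⊆Y w (X'⊆X w x'w))) , z , Y⊆Y' z yz , λ x'z → ¬xz (X'⊆X z x'z)

module _ {n : ℕ} where

  Gen-mono : ∀ {X Y : Subset n} → X ⊆ Y → Gen X ⊆ Gen Y
  Gen-mono X⊆Y z (gen-base x) = gen-base (X⊆Y z x)
  Gen-mono X⊆Y _ (gen-mul a b) = gen-mul (Gen-mono X⊆Y _ a) (Gen-mono X⊆Y _ b)

  Gen-minimal : ∀ {X Y : Subset n} → X ⊆ Gen Y → Gen X ⊆ Gen Y
  Gen-minimal X⊆GY z (gen-base x) = X⊆GY z x
  Gen-minimal X⊆GY _ (gen-mul a b) = gen-mul (Gen-minimal X⊆GY _ a) (Gen-minimal X⊆GY _ b)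

  Gen-resp : ∀ {X Y : Subset n} → X ≐ Y → Gen X ≐ Gen Y
  Gen-resp (a , b) = Gen-mono a , Gen-mono b

  Gen-∅ : ∀ z → ¬ Gen (∅ {n}) z
  Gen-∅ z (gen-base ())
  Gen-∅ _ (gen-mul a _) = Gen-∅ _ a

  adjoin-grows : ∀ {P : Subset n} {x} → (Gen P ⊂ Gen (P ∪ ｛ x ｝)) ⇔ (¬ Gen P x)
  adjoin-grows {P} {x} = mk⇔ grows⇒new new⇒grows
    where
    grows⇒new : Gen P ⊂ Gen (P ∪ ｛ x ｝) → ¬ Gen P x
    grows⇒new (_ , z , gz , ¬gz) gx =
      ¬gz (Gen-minimal (λ { w (inj₁ p) → gen-base p ; w (inj₂ refl) → gx }) z gz)
    new⇒grows : ¬ Gen P x → Gen P ⊂ Gen (P ∪ ｛ x ｝)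
    new⇒grows ¬gx = Gen-mono (λ _ → inj₁) , x , gen-base (inj₂ refl) , ¬gx

-- For P = ∅ this is the chain
-- condition defining faces, in a form suited to induction on the list.
module _ {n : ℕ} where

  Independent : Subset n → List (BElt n) → Set
  Independent P [] = ⊤
  Independent P (x ∷ xs) = ¬ Gen P x × Independent (P ∪ ｛ x ｝) xs

  StrictChain : Subset n → List (BElt n) → Set
  StrictChain P xs =
    ∀ i → i < length xs → Gen (P ∪ listSet (take i xs)) ⊂ Gen (P ∪ listSet (take (suc i) xs))

  strictChain⇔independent : ∀ P xs → StrictChain P xs ⇔ Independent P xs
  strictChain⇔independent P xs = mk⇔ (to P xs) (from P xs)
    where
    first : ∀ P x xs → Gen (P ∪ listSet (take 0 (x ∷ xs))) ≐ Gen P ×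
                       Gen (P ∪ listSet (take 1 (x ∷ xs))) ≐ Gen (P ∪ ｛ x ｝)
    first P x xs = Gen-resp (∪-[] P) , Gen-resp (≐-trans (∪-∷ P x []) (∪-[] _))
    later : ∀ P x xs i → Gen (P ∪ listSet (take (suc i) (x ∷ xs))) ≐ Gen ((P ∪ ｛ x ｝) ∪ listSet (take i xs))
    later P x xs i = Gen-resp (∪-∷ P x (take i xs))
    to : ∀ P xs → StrictChain P xs → Independent P xs
    to P [] _ = tt
    to P (x ∷ xs) chain =
      Equivalence.to adjoin-grows (⊂-resp (proj₁ (first P x xs)) (proj₂ (first P x xs)) (chain 0 (s≤s z≤n))) ,
      to (P ∪ ｛ x ｝) xs (λ i i< → ⊂-resp (later P x xs i) (later P x xs (suc i)) (chain (suc i) (s≤s i<)))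
    from : ∀ P xs → Independent P xs → StrictChain P xs
    from P (x ∷ xs) (new , _) zero _ =
      ⊂-resp (≐-sym (proj₁ (first P x xs))) (≐-sym (proj₂ (first P x xs))) (Equivalence.from adjoin-grows new)
    from P (x ∷ xs) (_ , rest) (suc i) (s≤s i<) =
      ⊂-resp (≐-sym (later P x xs i)) (≐-sym (later P x xs (suc i))) (from (P ∪ ｛ x ｝) xs rest i i<)

  face⇔independent : ∀ (X : Subset n) xs →
    IsChainEnumeration X xs ⇔ (Unique xs × (∀ z → (z ∈ xs) ⇔ X z) × Independent ∅ xs)
  face⇔independent X xs = mk⇔
    (λ (u , mem , chain) → u , mem , Equivalence.to (strictChain⇔independent ∅ xs) (λ i i< →
      ⊂-resp (fromListSet i) (fromListSet (suc i)) (chain i i<)))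
    (λ (u , mem , indep) → u , mem , λ i i< →
      ⊂-resp (≐-sym (fromListSet i)) (≐-sym (fromListSet (suc i)))
             (Equivalence.from (strictChain⇔independent ∅ xs) indep i i<))
    where
    fromListSet : ∀ i → Gen (listSet (take i xs)) ≐ Gen (∅ ∪ listSet (take i xs))
    fromListSet i = Gen-resp ((λ z → inj₂) , (λ { z (inj₁ ()) ; z (inj₂ m) → m }))

  Independent-resp : ∀ {P Q} xs → P ≐ Q → Independent P xs → Independent Q xs
  Independent-resp [] _ _ = tt
  Independent-resp (x ∷ xs) P≐Q (new , rest) =
    (λ g → new (Gen-mono (proj₂ P≐Q) x g)) , Independent-resp xs (∪-congˡ P≐Q) rest

  Independent-++ : ∀ P as bs → Independent P as → Independent (P ∪ listSet as) bs → Independent P (as ++ bs)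
  Independent-++ P [] bs _ indep = Independent-resp bs (∪-[] P) indep
  Independent-++ P (a ∷ as) bs (new , rest) indep =
    new , Independent-++ (P ∪ ｛ a ｝) as bs rest (Independent-resp bs (∪-∷ P a as) indep)

module _ {n : ℕ} where

  _≟B_ : DecidableEquality (BElt n)
  zeroB ≟B zeroB = yes refl
  zeroB ≟B pair _ _ = no λ ()
  pair _ _ ≟B zeroB = no λ ()
  pair i j ≟B pair k l with i ≟ k | j ≟ l
  ... | yes refl | yes refl = yes refl
  ... | no i≢k | _ = no λ { refl → i≢k refl }
  ... | _ | no j≢l = no λ { refl → j≢l refl }

  isIdem? : Decidable (IsIdem {n})
  isIdem? zeroB = yes idem-zero
  isIdem? (pair i j) with i ≟ j
  ... | yes refl = yes (idem-diag i)
  ... | no i≢j = no λ { (idem-diag _) → i≢j refl }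

  idem-diagonal : ∀ {i j : Fin n} → IsIdem (pair i j) → i ≡ j
  idem-diagonal (idem-diag _) = refl

  -- Idempotents act as partial identities: in a product, an idempotent
  -- either disappears or annihilates, so adjoining a set Q of idempotents
  -- to S only adds Q and 0 to the generated subsemigroup.
  gen-idempotents : ∀ {Q S : Subset n} → Q ⊆ IsIdem → Gen (Q ∪ S) ⊆ (Q ∪ ｛ zeroB ｝ ∪ Gen S)
  gen-idempotents Q⊆E z (gen-base (inj₁ q)) = inj₁ q
  gen-idempotents Q⊆E z (gen-base (inj₂ s)) = inj₂ (inj₂ (gen-base s))
  gen-idempotents {Q} {S} Q⊆E _ (gen-mul {a} {b} ga gb) =
    product a b (gen-idempotents Q⊆E a ga) (gen-idempotents Q⊆E b gb)
    where
    R : Subset n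
    R = Q ∪ ｛ zeroB ｝ ∪ Gen S
    product : ∀ a b → R a → R b → R (a · b)
    product zeroB b _ _ = inj₂ (inj₁ refl)
    product (pair i j) zeroB _ _ = inj₂ (inj₁ refl)
    product (pair i j) (pair k l) (inj₂ (inj₁ ())) _
    product (pair i j) (pair k l) _ (inj₂ (inj₁ ()))
    product (pair i j) (pair k l) (inj₁ qa) rb with j ≟ k | idem-diagonal (Q⊆E _ qa)
    ... | yes refl | refl = rb
    ... | no _ | _ = inj₂ (inj₁ refl)
    product (pair i j) (pair k l) ra@(inj₂ (inj₂ _)) (inj₁ qb) with j ≟ k | idem-diagonal (Q⊆E _ qb)
    ... | yes refl | refl = ra
    ... | no _ | _ = inj₂ (inj₁ refl)
    product (pair i j) (pair k l) (inj₂ (inj₂ ga)) (inj₂ (inj₂ gb)) = inj₂ (inj₂ (gen-mul ga gb))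

  non-idem-not-generated : ∀ {P Q : Subset n} {x} → ¬ IsIdem x → ¬ Gen P x →
                           Q ⊆ (IsIdem ∪ P) → ¬ Gen Q x
  non-idem-not-generated {x = x} ¬idem ¬gen Q⊆E∪P g
    with gen-idempotents (λ _ e → e) x (Gen-mono Q⊆E∪P x g)
  ... | inj₁ idem = ¬idem idem
  ... | inj₂ (inj₁ refl) = ¬idem idem-zero
  ... | inj₂ (inj₂ gen) = ¬gen gen

  independent-non-idem : ∀ {P Q : Subset n} xs → Independent P xs → Q ⊆ (IsIdem ∪ P) →
                         Independent Q (filter (¬? ∘ isIdem?) xs)
  independent-non-idem [] _ _ = tt
  independent-non-idem {P} {Q} (x ∷ xs) (new , rest) Q⊆E∪P with isIdem? x
  ... | yes _ = independent-non-idem xs rest λ z q → [ inj₁ , (λ p → inj₂ (inj₁ p)) ] (Q⊆E∪P z q)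
  ... | no ¬idem =
    non-idem-not-generated ¬idem new Q⊆E∪P ,
    independent-non-idem xs rest λ { z (inj₁ q) → [ inj₁ , (λ p → inj₂ (inj₁ p)) ] (Q⊆E∪P z q)
                                   ; z (inj₂ refl) → inj₂ (inj₂ refl) }

  diag : Fin n → BElt n
  diag i = pair i i

  diagonals-independent : ∀ {Q : Subset n} is → Q ⊆ IsIdem → (∀ i → i ∈ is → ¬ Q (diag i)) →
                          Unique is → Independent Q (map diag is)
  diagonals-independent [] _ _ _ = tt
  diagonals-independent {Q} (i ∷ is) Q⊆E ¬Q (fresh ∷ u) =
    not-generated ,
    diagonals-independent is
      (λ { z (inj₁ q) → Q⊆E z q ; z (inj₂ refl) → idem-diag i })
      (λ { j j∈ (inj₁ q) → ¬Q j (there j∈) q ; j j∈ (inj₂ refl) → All.lookup fresh j∈ refl })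
      u
    where
    not-generated : ¬ Gen Q (diag i)
    not-generated g with gen-idempotents {Q} {∅} Q⊆E _ (Gen-mono {X = Q} (λ _ → inj₁) _ g)
    ... | inj₁ q = ¬Q i (here refl) q
    ... | inj₂ (inj₁ ())
    ... | inj₂ (inj₂ g∅) = Gen-∅ _ g∅

module _ {n : ℕ} where

  idempotents : List (BElt n)
  idempotents = zeroB ∷ map diag (allFin n)

  idempotents-complete : ∀ z → (z ∈ idempotents) ⇔ IsIdem z
  idempotents-complete z = mk⇔ to from
    where
    to : z ∈ idempotents → IsIdem z
    to (here refl) = idem-zero
    to (there m) with ∈-map⁻ diag m
    ... | i , _ , refl = idem-diag i
    from : IsIdem z → z ∈ idempotents
    from idem-zero = here refl
    from (idem-diag i) = there (∈-map⁺ diag (∈-allFin i))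

  idempotents-unique : Unique idempotents
  idempotents-unique = All.tabulate zero-not-diag ∷ Unique.map⁺ diag-injective (Unique.allFin⁺ n)
    where
    zero-not-diag : ∀ {x} → x ∈ map diag (allFin n) → zeroB ≢ x
    zero-not-diag m refl with ∈-map⁻ diag m
    ... | _ , _ , ()
    diag-injective : ∀ {i j} → diag i ≡ diag j → i ≡ j
    diag-injective refl = refl

  idempotents-independent : Independent ∅ idempotents
  idempotents-independent =
    Gen-∅ zeroB ,
    diagonals-independent (allFin n)
      (λ { z (inj₁ ()) ; z (inj₂ refl) → idem-zero })
      (λ { i _ (inj₁ ()) ; i _ (inj₂ ()) })
      (Unique.allFin⁺ n)

  -- If F is a face, so is E(B(n)) ∪ F: enumerate the idempotents first and
  -- then the non-idempotent elements of F in their original order.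
  face-with-idempotents : ∀ {F : Subset n} → IsFace F → IsFace (IsIdem ∪ F)
  face-with-idempotents {F} (xs , face) with Equivalence.to (face⇔independent F xs) face
  ... | unique , mem , indep =
    ys , Equivalence.from (face⇔independent _ ys) (ys-unique , ys-mem , ys-independent)
    where
    nonIdem = filter (¬? ∘ isIdem?) xs
    ys = idempotents ++ nonIdem
    ys-unique : Unique ys
    ys-unique = Unique.++⁺ idempotents-unique (Unique.filter⁺ (¬? ∘ isIdem?) unique)
      λ (m₁ , m₂) → proj₂ (∈-filter⁻ (¬? ∘ isIdem?) {xs = xs} m₂)
                          (Equivalence.to (idempotents-complete _) m₁)
    ys-mem : ∀ z → (z ∈ ys) ⇔ (IsIdem ∪ F) z
    ys-mem z = mk⇔ to from
      where
      to : z ∈ ys → (IsIdem ∪ F) z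
      to m with ∈-++⁻ idempotents m
      ... | inj₁ m₁ = inj₁ (Equivalence.to (idempotents-complete z) m₁)
      ... | inj₂ m₂ = inj₂ (Equivalence.to (mem z) (proj₁ (∈-filter⁻ (¬? ∘ isIdem?) {xs = xs} m₂)))
      from : (IsIdem ∪ F) z → z ∈ ys
      from (inj₁ idem) = ∈-++⁺ˡ (Equivalence.from (idempotents-complete z) idem)
      from (inj₂ f) with isIdem? z
      ... | yes idem = ∈-++⁺ˡ (Equivalence.from (idempotents-complete z) idem)
      ... | no ¬idem = ∈-++⁺ʳ idempotents (∈-filter⁺ (¬? ∘ isIdem?) (Equivalence.from (mem z) f) ¬idem)
    ys-independent : Independent ∅ ys
    ys-independent = Independent-++ ∅ idempotents nonIdem idempotents-independent
      (independent-non-idem xs indep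
        λ { z (inj₁ ()) ; z (inj₂ m) → inj₁ (Equivalence.to (idempotents-complete z) m) })

  facet-contains-idempotents : ∀ {F : Subset n} → IsFacet F → IsIdem ⊆ F
  facet-contains-idempotents (face , maximal) z idem =
    maximal _ (face-with-idempotents face) (λ _ → inj₂) z (inj₁ idem)

  face-decidable : ∀ {F : Subset n} → IsFace F → Decidable F
  face-decidable {F} (xs , _ , mem , _) z with DecMembership._∈?_ _≟B_ z xs
  ... | yes m = yes (Equivalence.to (mem z) m)
  ... | no ¬m = no λ f → ¬m (Equivalence.from (mem z) f)

module ContainedOrders {n : ℕ} (F : Subset n) (F? : Decidable F) (idem⊆F : IsIdem ⊆ F)
  (T O : Relation n) (T-sym : ∀ p q → T p q → T q p) (orient : IsOrientationOfComplement T O)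
  (split : ∀ z → (F z × ¬ IsIdem z) ⇔
             ((∃ λ p → ∃ λ q → T p q × z ≡ pair p q) ⊎ (∃ λ p → ∃ λ q → O p q × z ≡ pair p q)))
  where

  private
    O-off-T : ∀ p q → O p q → p ≢ q × ¬ T p q
    O-off-T = proj₁ orient
    O-asym : ∀ p q → O p q → ¬ O q p
    O-asym = proj₁ (proj₂ orient)
    O-total : ∀ p q → p ≢ q → ¬ T p q → O p q ⊎ O q p
    O-total = proj₂ (proj₂ orient)

  Contained : BoolRel n → Set
  Contained L = ∀ i j → i ⟨ L ⟩ j → F (pair i j)

  T⊆F : ∀ {p q} → T p q → F (pair p q)
  T⊆F {p} {q} t = proj₁ (Equivalence.from (split (pair p q)) (inj₁ (p , q , t , refl)))

  O⊆F : ∀ {p q} → O p q → F (pair p q)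
  O⊆F {p} {q} o = proj₁ (Equivalence.from (split (pair p q)) (inj₂ (p , q , o , refl)))

  F-off-diagonal : ∀ {p q} → F (pair p q) → p ≢ q → T p q ⊎ O p q
  F-off-diagonal {p} {q} f p≢q with Equivalence.to (split (pair p q)) (f , λ idem → p≢q (idem-diagonal idem))
  ... | inj₁ (_ , _ , t , refl) = inj₁ t
  ... | inj₂ (_ , _ , o , refl) = inj₂ o

  O-reverse-∉F : ∀ {p q} → O p q → ¬ F (pair q p)
  O-reverse-∉F {p} {q} o f with F-off-diagonal f (λ q≡p → proj₁ (O-off-T p q o) (sym q≡p))
  ... | inj₁ t = proj₂ (O-off-T p q o) (T-sym q p t)
  ... | inj₂ o' = O-asym p q o o'

  contained⇒O⊆L : ∀ {L} → IsStrictLinearOrder L → Contained L → ∀ {p q} → O p q → p ⟨ L ⟩ q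
  contained⇒O⊆L (_ , _ , total) L⊆F {p} {q} o with total p q (proj₁ (O-off-T p q o))
  ... | inj₁ p<q = p<q
  ... | inj₂ q<p = ⊥-elim (O-reverse-∉F o (L⊆F q p q<p))

  Φ-characterisation : ∀ L → IsStrictLinearOrder L → (∀ z → F z ⇔ Φ L T z) ⇔ Contained L
  Φ-characterisation L slo@(_ , _ , total) = mk⇔ to from
    where
    to : (∀ z → F z ⇔ Φ L T z) → Contained L
    to F≡Φ i j i<j = Equivalence.from (F≡Φ (pair i j)) (inj₂ (inj₁ (i , j , i<j , refl)))
    F⊆Φ : Contained L → ∀ z → F z → Φ L T z
    F⊆Φ _ zeroB _ = inj₁ refl
    F⊆Φ L⊆F (pair i j) f with i ≟ j
    ... | yes refl = inj₂ (inj₂ (inj₁ (idem-diag i)))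
    ... | no i≢j with F-off-diagonal f i≢j
    ...   | inj₂ o = inj₂ (inj₁ (i , j , contained⇒O⊆L {L} slo L⊆F o , refl))
    ...   | inj₁ t with total i j i≢j
    ...     | inj₁ i<j = inj₂ (inj₁ (i , j , i<j , refl))
    ...     | inj₂ j<i = inj₂ (inj₂ (inj₂ (i , j , (t , j<i) , refl)))
    Φ⊆F : Contained L → ∀ z → Φ L T z → F z
    Φ⊆F _ z (inj₁ refl) = idem⊆F zeroB idem-zero
    Φ⊆F L⊆F z (inj₂ (inj₁ (i , j , i<j , refl))) = L⊆F i j i<j
    Φ⊆F _ z (inj₂ (inj₂ (inj₁ idem))) = idem⊆F z idem
    Φ⊆F _ z (inj₂ (inj₂ (inj₂ (p , q , (t , _) , refl)))) = T⊆F t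
    from : Contained L → ∀ z → F z ⇔ Φ L T z
    from L⊆F z = mk⇔ (F⊆Φ L⊆F z) (Φ⊆F L⊆F z)

  extension-characterisation : ∀ L → IsStrictLinearOrder L →
    (∀ v w → v ≤[ O ] w → v ≢ w → v ⟨ L ⟩ w) ⇔ Contained L
  extension-characterisation L slo@(irrefl , trans , _) = mk⇔ to from
    where
    to : (∀ v w → v ≤[ O ] w → v ≢ w → v ⟨ L ⟩ w) → Contained L
    to extends i j i<j with F? (pair i j)
    ... | yes f = f
    ... | no ¬f with O-total i j (λ { refl → irrefl i i<j }) (λ t → ¬f (T⊆F t))
    ...   | inj₁ o = ⊥-elim (¬f (O⊆F o))
    ...   | inj₂ o = ⊥-elim (irrefl i (trans i j i i<j (extends j i (o ◅ ε) (proj₁ (O-off-T j i o)))))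
    path⇒≤ : Contained L → ∀ {v w} → v ≤[ O ] w → v ≡ w ⊎ v ⟨ L ⟩ w
    path⇒≤ _ ε = inj₁ refl
    path⇒≤ L⊆F (o ◅ path) with path⇒≤ L⊆F path
    ... | inj₁ refl = inj₂ (contained⇒O⊆L {L} slo L⊆F o)
    ... | inj₂ lt = inj₂ (trans _ _ _ (contained⇒O⊆L {L} slo L⊆F o) lt)
    from : Contained L → ∀ v w → v ≤[ O ] w → v ≢ w → v ⟨ L ⟩ w
    from L⊆F v w path v≢w with path⇒≤ L⊆F path
    ... | inj₁ v≡w = ⊥-elim (v≢w v≡w)
    ... | inj₂ v<w = v<w

  contained-order? : Decidable (λ L → IsStrictLinearOrder L × Contained L)
  contained-order? L =
    ((all? λ i → ¬? (lt? i i)) ×-dec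
     (all? λ i → all? λ j → all? λ k → lt? i j →-dec (lt? j k →-dec lt? i k)) ×-dec
     (all? λ i → all? λ j → ¬? (i ≟ j) →-dec (lt? i j ⊎-dec lt? j i)))
    ×-dec (all? λ i → all? λ j → lt? i j →-dec F? (pair i j))
    where
    lt? : ∀ i j → Dec (i ⟨ L ⟩ j)
    lt? i j = lookup (lookup L i) j Bool.≟ true

HasCard-resp : ∀ {A : Set} {P Q : A → Set} {k} → (∀ x → P x ⇔ Q x) → HasCard P k → HasCard Q k
HasCard-resp P⇔Q (xs , unique , mem , len) =
  xs , unique , (λ x → mk⇔ (Equivalence.to (P⇔Q x) ∘ Equivalence.to (mem x))
                           (Equivalence.from (mem x) ∘ Equivalence.from (P⇔Q x))) , len

decidable-card : ∀ {A : Set} → DecidableEquality A → (as : List A) → (∀ a → a ∈ as) →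
                 ∀ {P : A → Set} → Decidable P → ∃ (HasCard P)
decidable-card _≟A_ as complete P? =
  length ys , ys , Unique.filter⁺ P? (UniqueDec.deduplicate-! _≟A_ as) , mem , refl
  where
  ys = filter P? (deduplicate _≟A_ as)
  mem : ∀ a → (a ∈ ys) ⇔ _
  mem a = mk⇔ (λ m → proj₂ (∈-filter⁻ P? {xs = deduplicate _≟A_ as} m))
              (∈-filter⁺ P? (∈-deduplicate⁺ _≟A_ (complete a)))

allVecs : ∀ {A : Set} → List A → (m : ℕ) → List (Vec A m)
allVecs as zero = [] ∷ []
allVecs as (suc m) = cartesianProductWith _∷_ as (allVecs as m)

allVecs-complete : ∀ {A : Set} (as : List A) → (∀ a → a ∈ as) → ∀ m (v : Vec A m) → v ∈ allVecs as m
allVecs-complete as complete zero [] = here refl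
allVecs-complete as complete (suc m) (x ∷ v) =
  ∈-cartesianProductWith⁺ _∷_ (complete x) (allVecs-complete as complete m v)

allBoolRels : ∀ n → List (BoolRel n)
allBoolRels n = allVecs (allVecs (true ∷ false ∷ []) n) n

allBoolRels-complete : ∀ n (L : BoolRel n) → L ∈ allBoolRels n
allBoolRels-complete n = allVecs-complete _ (allVecs-complete _ bool∈ n) n
  where
  bool∈ : ∀ b → b ∈ true ∷ false ∷ []
  bool∈ true = here refl
  bool∈ false = there (here refl)

theorem5p23 : (n : ℕ) → 1 ≤ n →
  (F : Subset n) → IsFacet F →
  (T O : Relation n) → IsSpanningTree T → IsOrientationOfComplement T O → IsAcyclic O →
  (∀ z → (F z × ¬ IsIdem z) ⇔ ((∃ λ p → ∃ λ q → T p q × z ≡ pair p q) ⊎ (∃ λ p → ∃ λ q → O p q × z ≡ pair p q))) →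
  ∃ λ k →
    HasCard (λ (L : BoolRel n) → IsStrictLinearOrder L × (∀ z → F z ⇔ Φ L T z)) k ×
    HasCard (λ (L : BoolRel n) → IsLinearExtension L O) k
theorem5p23 n _ F facet T O ((T-sym , _) , _) orient _ split =
  k , HasCard-resp (same Φ-characterisation) card , HasCard-resp (same extension-characterisation) card
  where
  open ContainedOrders F (face-decidable (proj₁ facet)) (facet-contains-idempotents facet) T O T-sym orient split
  counted = decidable-card (Vec.≡-dec (Vec.≡-dec Bool._≟_)) (allBoolRels n) (allBoolRels-complete n) contained-order?
  k = proj₁ counted
  card = proj₂ counted
  same : ∀ {P : BoolRel n → Set} → (∀ L → IsStrictLinearOrder L → P L ⇔ Contained L) →
         ∀ L → (IsStrictLinearOrder L × Contained L) ⇔ (IsStrictLinearOrder L × P L)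
  same char L = mk⇔ (λ (slo , c) → slo , Equivalence.from (char L slo) c)
                    (λ (slo , p) → slo , Equivalence.to (char L slo) p)
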